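{- Let $n\ge 3$ and let $\boldsymbol{\pi}\in\mathfrak{S}_n$ be of the form $2Ln1$, i.e. $\pi_1=2$, $\pi_{n-1}=n$, $\pi_n=1$, and $L=\pi_2\cdots\pi_{n-2}$ is any permutation of $\{3,4,\dots,n-1\}$. Then every element of $\mathcal{S}^{\boldsymbol{\pi}}$ other than $\mathbf{e}$ begins with $2$.
   Context: $\mathbf{e}=12\cdots n$. The stack-sorting map $s$: start with an empty stack and read entries left to right; for each entry $x$, while the stack is nonempty and its top $t<x$, pop $t$ to the output; then push $x$. At the end, pop the remaining stack elements to the output; the output is $s(\boldsymbol{\pi})$. $\mathcal{S}^{\boldsymbol{\pi}}=\{\boldsymbol{\pi},s(\boldsymbol{\pi}),s^2(\boldsymbol{\pi}),\dots,\mathbf{e}\}$ (iterating until $\mathbf{e}$ is reached). -}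

module Defs where

open import Data.Nat using (ℕ; zero; suc; _<ᵇ_)
open import Data.Bool using (if_then_else_)
open import Data.List using (List; []; _∷_; _++_; reverse; map; upTo)

idPerm : ℕ → List ℕ
idPerm n = map suc (upTo n)

-- The stack is a list whose head is the top;
-- the output is accumulated in reverse order.
pushStep : ℕ → List ℕ → List ℕ → (List ℕ → List ℕ → List ℕ) → List ℕ
pushStep x []      out k = k (x ∷ []) out
pushStep x (t ∷ st) out k =
  if t <ᵇ x then pushStep x st (t ∷ out) k else k (x ∷ t ∷ st) out

run : List ℕ → List ℕ → List ℕ → List ℕ
run []       st out = reverse out ++ st
run (x ∷ xs) st out = pushStep x st out (λ st' out' → run xs st' out')

stackSort : List ℕ → List ℕ
stackSort w = run w [] []

iter : ℕ → (List ℕ → List ℕ) → List ℕ → List ℕ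
iter zero    f w = w
iter (suc k) f w = f (iter k f w)

open import Data.Nat using (_+_; _∸_)
threeTo : ℕ → List ℕ
threeTo n = map (_+ 3) (upTo (n ∸ 3))

{-# OPTIONS --safe #-}
-- Call a word 2 X 1 Y good when X Y is a rearrangement of 3 … n and Y is increasing;
-- 2 L n 1 is good with Y empty.  Sorting a good word with X = x X′ nonempty, 2 is popped
-- as soon as x arrives, X′ is then processed leaving a stack S that increases from the
-- top, 1 is pushed onto S, and as Y is read 1 leaves first and the rest of S merges
-- with Y.  So s(2 X 1 Y) = 2 X″ 1 Y′ with Y′ the (increasing) merge of S and Y: good
-- again.  When X is empty, s(2 1 Y) = 1 2 Y = e, which s fixes.
module Submission where

open import Defs
open import Data.Nat using (ℕ; _≥_)
open import Data.List using (List; []; _∷_; _++_; head)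
open import Data.Maybe using (just)
open import Data.List.Relation.Binary.Permutation.Propositional using (_↭_)
open import Relation.Binary.PropositionalEquality using (_≡_; _≢_)

open import Data.Nat using (zero; suc; _+_; _<_; _≤_; _<ᵇ_; s≤s; z≤n)
open import Data.Nat.Properties
  using (_≤?_; ≤-trans; <-trans; <⇒≤; <⇒≱; ≮⇒≥; ≤∧≢⇒<; <⇒≢; +-comm;
         <ᵇ-reflects-<; ≤-totalOrder; ≤-decTotalOrder)
open import Data.Product using (_×_; _,_; proj₁; proj₂; uncurry)
open import Data.Sum using (_⊎_; inj₁; inj₂)
open import Data.Empty using (⊥-elim)
open import Function using (id; _∘_)
open import Data.Bool using (true; false; if_then_else_)
open import Data.List using (reverse; map; upTo; applyUpTo; merge; _∷ʳ_)
open import Data.List.Properties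
  using (++-assoc; ++-identityʳ; unfold-reverse; reverse-++; map-++; map-cong; map-applyUpTo; upTo-∷ʳ)
open import Data.List.Relation.Unary.All as All using (All; []; _∷_)
open import Data.List.Relation.Unary.All.Properties using (++⁻ˡ; ++⁻ʳ)
open import Data.List.Relation.Unary.AllPairs as AllPairs using (AllPairs; _∷_)
import Data.List.Relation.Unary.AllPairs.Properties as AllPairsₚ
open import Data.List.Relation.Unary.Linked as Linked using ([]; [-]; _∷_)
open import Data.List.Relation.Unary.Linked.Properties using (Linked⇒AllPairs; AllPairs⇒Linked)
open import Data.List.Relation.Unary.Sorted.TotalOrder ≤-totalOrder using (Sorted)
open import Data.List.Relation.Unary.Sorted.TotalOrder.Properties using (↗↭↗⇒≋; merge⁺)
open import Data.List.Relation.Binary.Pointwise using (Pointwise-≡⇒≡)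
open import Data.List.Relation.Binary.Permutation.Propositional
  using (↭-sym; ↭-trans; ↭-reflexive; ↭⇒↭ₛ; module PermutationReasoning)
open import Data.List.Relation.Binary.Permutation.Propositional.Properties
  using (All-resp-↭; ++⁺; ++⁺ˡ; ++⁺ʳ; ++-comm; ↭-reverse; merge-↭)
open import Data.List.Relation.Binary.Permutation.Setoid.Properties using (Unique-resp-↭)
open import Relation.Binary.PropositionalEquality
  using (refl; sym; trans; cong; cong₂; subst; setoid; module ≡-Reasoning)
open import Relation.Nullary using (contradiction)
open import Relation.Nullary.Decidable using (dec-true; dec-false)
open import Relation.Nullary.Reflects using (ofʸ; ofⁿ)

private
  variable
    x t : ℕ
    xs ys st out : List ℕ

sorted-↭⇒≡ : Sorted xs → Sorted ys → xs ↭ ys → xs ≡ ys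
sorted-↭⇒≡ xs↗ ys↗ xs↭ys = Pointwise-≡⇒≡ (↗↭↗⇒≋ ≤-totalOrder xs↗ ys↗ (↭⇒↭ₛ xs↭ys))

sorted-distinct⇒increasing : Sorted xs → AllPairs _≢_ xs → AllPairs _<_ xs
sorted-distinct⇒increasing xs↗ xs≢ = AllPairs.zipWith (uncurry ≤∧≢⇒<) (Linked⇒AllPairs ≤-trans xs↗ , xs≢)

distinct-↭ : xs ↭ ys → AllPairs _≢_ ys → AllPairs _≢_ xs
distinct-↭ xs↭ys = Unique-resp-↭ (setoid ℕ) (↭⇒↭ₛ (↭-sym xs↭ys))

AllPairs-++⁻ʳ : ∀ {R : ℕ → ℕ → Set} xs → AllPairs R (xs ++ ys) → AllPairs R ys
AllPairs-++⁻ʳ []       xs++ys↑       = xs++ys↑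
AllPairs-++⁻ʳ (_ ∷ xs) (_ ∷ xs++ys↑) = AllPairs-++⁻ʳ xs xs++ys↑

run-pop : t < x → run (x ∷ xs) (t ∷ st) out ≡ run (x ∷ xs) st (t ∷ out)
run-pop {t} {x} t<x with t <ᵇ x | <ᵇ-reflects-< t x
... | true  | _        = refl
... | false | ofⁿ t≮x = contradiction t<x t≮x

run-push : All (x ≤_) st → run (x ∷ xs) st out ≡ run xs (x ∷ st) out
run-push [] = refl
run-push {x} {t ∷ st} (x≤t ∷ _) with t <ᵇ x | <ᵇ-reflects-< t x
... | false | _        = refl
... | true  | ofʸ t<x = contradiction x≤t (<⇒≱ t<x)

merge-[]ʳ : ∀ xs → merge _≤?_ xs [] ≡ xs
merge-[]ʳ []       = refl
merge-[]ʳ (_ ∷ _) = refl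

merge-head : ∀ {y} ys st → All (y <_) ys → merge _≤?_ ys (y ∷ st) ≡ y ∷ merge _≤?_ ys st
merge-head []       st _            = refl
merge-head (z ∷ zs) st (y<z ∷ _) rewrite dec-false (z ≤? _) (<⇒≱ y<z) = refl

run-increasing : ∀ ys st out → AllPairs _<_ ys → run ys st out ≡ reverse out ++ merge _≤?_ ys st
run-increasing []       st out _ = refl
run-increasing (y ∷ ys) st out (y<ys ∷ ys↑) = read-y st out
  where
  open ≡-Reasoning
  read-y : ∀ st out → run (y ∷ ys) st out ≡ reverse out ++ merge _≤?_ (y ∷ ys) st
  read-y [] out = begin
    run ys (y ∷ []) out                   ≡⟨ run-increasing ys (y ∷ []) out ys↑ ⟩
    reverse out ++ merge _≤?_ ys (y ∷ []) ≡⟨ cong (reverse out ++_) (merge-head ys [] y<ys) ⟩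
    reverse out ++ y ∷ merge _≤?_ ys []   ≡⟨ cong (λ zs → reverse out ++ y ∷ zs) (merge-[]ʳ ys) ⟩
    reverse out ++ y ∷ ys                 ∎
  read-y (t ∷ st) out with t <ᵇ y | <ᵇ-reflects-< t y
  ... | true  | ofʸ t<y rewrite dec-false (y ≤? t) (<⇒≱ t<y) = begin
    run (y ∷ ys) st (t ∷ out)                    ≡⟨ read-y st (t ∷ out) ⟩
    reverse (t ∷ out) ++ merge _≤?_ (y ∷ ys) st  ≡⟨ cong (_++ _) (unfold-reverse t out) ⟩
    (reverse out ∷ʳ t) ++ merge _≤?_ (y ∷ ys) st ≡⟨ ++-assoc (reverse out) _ _ ⟩
    reverse out ++ t ∷ merge _≤?_ (y ∷ ys) st    ∎
  ... | false | ofⁿ t≮y rewrite dec-true (y ≤? t) (≮⇒≥ t≮y) = begin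
    run ys (y ∷ t ∷ st) out                      ≡⟨ run-increasing ys (y ∷ t ∷ st) out ys↑ ⟩
    reverse out ++ merge _≤?_ ys (y ∷ t ∷ st)    ≡⟨ cong (reverse out ++_) (merge-head ys (t ∷ st) y<ys) ⟩
    reverse out ++ y ∷ merge _≤?_ ys (t ∷ st)    ∎

stackSort-increasing : AllPairs _<_ xs → stackSort xs ≡ xs
stackSort-increasing {xs} xs↑ = trans (run-increasing xs [] [] xs↑) (merge-[]ʳ xs)

pushS : ℕ → List ℕ → List ℕ → List ℕ × List ℕ
pushS x []       out = x ∷ [] , out
pushS x (t ∷ st) out = if t <ᵇ x then pushS x st (t ∷ out) else (x ∷ t ∷ st , out)

runS : List ℕ → List ℕ → List ℕ → List ℕ × List ℕ
runS []       st out = st , out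
runS (x ∷ xs) st out = uncurry (runS xs) (pushS x st out)

pushStep-pushS : ∀ x st out (k : List ℕ → List ℕ → List ℕ) →
                 pushStep x st out k ≡ uncurry k (pushS x st out)
pushStep-pushS x []       out k = refl
pushStep-pushS x (t ∷ st) out k with t <ᵇ x
... | true  = pushStep-pushS x st (t ∷ out) k
... | false = refl

run-++ : ∀ xs ys st out → run (xs ++ ys) st out ≡ uncurry (run ys) (runS xs st out)
run-++ []       ys st out = refl
run-++ (x ∷ xs) ys st out = trans (pushStep-pushS x st out _) (run-++ xs ys _ _)

-- States are pairs (stack, reversed output), top of the stack first.
record Moves (xs : List ℕ) (before after : List ℕ × List ℕ) : Set where
  field
    popped  : List ℕ
    output≡ : proj₂ after ≡ popped ++ proj₂ before
    stack↭  : popped ++ proj₁ after ↭ proj₁ before ++ xs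

pop-moves : Moves [] (t ∷ st , out) (st , t ∷ out)
pop-moves {t} {st} = record
  { popped = t ∷ [] ; output≡ = refl ; stack↭ = ↭-sym (↭-reflexive (++-identityʳ (t ∷ st))) }

push-moves : Moves (x ∷ []) (st , out) (x ∷ st , out)
push-moves {x} {st} = record { popped = [] ; output≡ = refl ; stack↭ = ↭-sym (++-comm st (x ∷ [])) }

moves-++ : ∀ {s₁ s₂ s₃} → Moves xs s₁ s₂ → Moves ys s₂ s₃ → Moves (xs ++ ys) s₁ s₃
moves-++ {xs} {ys} {st₁ , out₁} {st₂ , out₂} {st₃ , out₃} m₁ m₂ = record
  { popped  = Q₂ ++ Q₁
  ; output≡ = trans M₂.output≡ (trans (cong (Q₂ ++_) M₁.output≡) (sym (++-assoc Q₂ Q₁ out₁)))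
  ; stack↭  = begin
      (Q₂ ++ Q₁) ++ st₃    ↭⟨ ++⁺ʳ st₃ (++-comm Q₂ Q₁) ⟩
      (Q₁ ++ Q₂) ++ st₃    ≡⟨ ++-assoc Q₁ Q₂ st₃ ⟩
      Q₁ ++ Q₂ ++ st₃      ↭⟨ ++⁺ˡ Q₁ M₂.stack↭ ⟩
      Q₁ ++ st₂ ++ ys      ≡⟨ ++-assoc Q₁ st₂ ys ⟨
      (Q₁ ++ st₂) ++ ys    ↭⟨ ++⁺ʳ ys M₁.stack↭ ⟩
      (st₁ ++ xs) ++ ys    ≡⟨ ++-assoc st₁ xs ys ⟩
      st₁ ++ xs ++ ys      ∎
  }
  where
  open PermutationReasoning
  module M₁ = Moves m₁
  module M₂ = Moves m₂
  Q₁ = M₁.popped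
  Q₂ = M₂.popped

pushS-moves : ∀ x st out → Moves (x ∷ []) (st , out) (pushS x st out)
pushS-moves x []       out = push-moves
pushS-moves x (t ∷ st) out with t <ᵇ x
... | true  = moves-++ pop-moves (pushS-moves x st (t ∷ out))
... | false = push-moves

runS-moves : ∀ xs st out → Moves xs (st , out) (runS xs st out)
runS-moves []       st out = record
  { popped = [] ; output≡ = refl ; stack↭ = ↭-sym (↭-reflexive (++-identityʳ st)) }
runS-moves (x ∷ xs) st out = moves-++ (pushS-moves x st out) (runS-moves xs _ _)

pushS-sorted : ∀ x st out → Sorted st → Sorted (proj₁ (pushS x st out))
pushS-sorted x []       out _     = [-]
pushS-sorted x (t ∷ st) out t∷st↗ with t <ᵇ x | <ᵇ-reflects-< t x
... | true  | _        = pushS-sorted x st (t ∷ out) (Linked.tail t∷st↗)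
... | false | ofⁿ t≮x = ≮⇒≥ t≮x ∷ t∷st↗

runS-sorted : ∀ xs st out → Sorted st → Sorted (proj₁ (runS xs st out))
runS-sorted []       st out st↗ = st↗
runS-sorted (x ∷ xs) st out st↗ = runS-sorted xs _ _ (pushS-sorted x st out st↗)

record Form2X1Y (U w : List ℕ) : Set where
  constructor form
  field
    X Y      : List ℕ
    shape    : w ≡ 2 ∷ X ++ 1 ∷ Y
    Y-sorted : Sorted Y
    XY↭U     : X ++ Y ↭ U

module _ {U : List ℕ} (12U↑ : AllPairs _<_ (1 ∷ 2 ∷ U)) where

  private
    2<U : All (2 <_) U
    2<U = AllPairs.head (AllPairs.tail 12U↑)

    U↑ : AllPairs _<_ U
    U↑ = AllPairs.tail (AllPairs.tail 12U↑)

    1<2 : 1 < 2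
    1<2 = s≤s (s≤s z≤n)

  stackSort-21U : stackSort (2 ∷ 1 ∷ U) ≡ 1 ∷ 2 ∷ U
  stackSort-21U = begin
    run U (1 ∷ 2 ∷ []) []       ≡⟨ run-increasing U _ [] U↑ ⟩
    merge _≤?_ U (1 ∷ 2 ∷ [])   ≡⟨ merge-head U _ (All.tail (AllPairs.head 12U↑)) ⟩
    1 ∷ merge _≤?_ U (2 ∷ [])   ≡⟨ cong (1 ∷_) (merge-head U [] 2<U) ⟩
    1 ∷ 2 ∷ merge _≤?_ U []     ≡⟨ cong (λ zs → 1 ∷ 2 ∷ zs) (merge-[]ʳ U) ⟩
    1 ∷ 2 ∷ U                   ∎
    where open ≡-Reasoning

  stackSort-2xX1Y : ∀ {x X Y} → Sorted Y → x ∷ X ++ Y ↭ U →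
                    Form2X1Y U (stackSort (2 ∷ (x ∷ X) ++ 1 ∷ Y))
  stackSort-2xX1Y {x} {X} {Y} Y↗ xXY↭U = form (reverse popped) (merge _≤?_ Y S) computation
    (merge⁺ ≤-decTotalOrder Y↗ (runS-sorted X (x ∷ []) (2 ∷ []) [-])) rearrangement
    where
    S = proj₁ (runS X (x ∷ []) (2 ∷ []))
    O = proj₂ (runS X (x ∷ []) (2 ∷ []))
    open Moves (runS-moves X (x ∷ []) (2 ∷ []))

    2<xXY : All (2 <_) (x ∷ X ++ Y)
    2<xXY = All-resp-↭ (↭-sym xXY↭U) 2<U

    x>2 : 2 < x
    x>2 = All.head 2<xXY

    S≥1 : All (1 ≤_) S
    S≥1 = All.map (<⇒≤ ∘ <-trans 1<2) (++⁻ʳ popped (All-resp-↭ (↭-sym stack↭) (++⁻ˡ (x ∷ X) 2<xXY)))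

    Y>1 : All (1 <_) Y
    Y>1 = All.map (<-trans 1<2) (++⁻ʳ (x ∷ X) 2<xXY)

    Y↑ : AllPairs _<_ Y
    Y↑ = sorted-distinct⇒increasing Y↗ (AllPairs-++⁻ʳ (x ∷ X) (distinct-↭ xXY↭U (AllPairs.map <⇒≢ U↑)))

    computation : stackSort (2 ∷ (x ∷ X) ++ 1 ∷ Y) ≡ 2 ∷ reverse popped ++ 1 ∷ merge _≤?_ Y S
    computation = begin
      run (x ∷ X ++ 1 ∷ Y) (2 ∷ []) []
        ≡⟨ run-pop {xs = X ++ 1 ∷ Y} {st = []} {out = []} x>2 ⟩
      run (X ++ 1 ∷ Y) (x ∷ []) (2 ∷ [])
        ≡⟨ run-++ X (1 ∷ Y) _ _ ⟩
      run (1 ∷ Y) S O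
        ≡⟨ run-push {xs = Y} S≥1 ⟩
      run Y (1 ∷ S) O
        ≡⟨ run-increasing Y (1 ∷ S) O Y↑ ⟩
      reverse O ++ merge _≤?_ Y (1 ∷ S)
        ≡⟨ cong₂ (λ o m → reverse o ++ m) output≡ (merge-head Y S Y>1) ⟩
      reverse (popped ++ 2 ∷ []) ++ 1 ∷ merge _≤?_ Y S
        ≡⟨ cong (_++ 1 ∷ merge _≤?_ Y S) (reverse-++ popped (2 ∷ [])) ⟩
      2 ∷ reverse popped ++ 1 ∷ merge _≤?_ Y S
        ∎
      where open ≡-Reasoning

    rearrangement : reverse popped ++ merge _≤?_ Y S ↭ U
    rearrangement = begin
      reverse popped ++ merge _≤?_ Y S ↭⟨ ++⁺ (↭-reverse popped) (merge-↭ _≤?_ Y S) ⟩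
      popped ++ Y ++ S                 ↭⟨ ++⁺ˡ popped (++-comm Y S) ⟩
      popped ++ S ++ Y                 ≡⟨ ++-assoc popped S Y ⟨
      (popped ++ S) ++ Y               ↭⟨ ++⁺ʳ Y stack↭ ⟩
      x ∷ X ++ Y                       ↭⟨ xXY↭U ⟩
      U                                ∎
      where open PermutationReasoning

  stackSort-2X1Y : ∀ {w} → Form2X1Y U w → stackSort w ≡ 1 ∷ 2 ∷ U ⊎ Form2X1Y U (stackSort w)
  stackSort-2X1Y (form []      Y refl Y↗ Y↭U)   =
    inj₁ (trans (cong (λ ys → stackSort (2 ∷ 1 ∷ ys)) (sorted-↭⇒≡ Y↗ U↗ Y↭U)) stackSort-21U)
    where U↗ = Linked.map <⇒≤ (AllPairs⇒Linked U↑)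
  stackSort-2X1Y (form (_ ∷ _) Y refl Y↗ xXY↭U) = inj₂ (stackSort-2xX1Y Y↗ xXY↭U)

  iter-stackSort-2X1Y : ∀ {w} → Form2X1Y U w → ∀ k →
                        iter k stackSort w ≡ 1 ∷ 2 ∷ U ⊎ Form2X1Y U (iter k stackSort w)
  iter-stackSort-2X1Y w₂₁ zero    = inj₂ w₂₁
  iter-stackSort-2X1Y w₂₁ (suc k) with iter-stackSort-2X1Y w₂₁ k
  ... | inj₁ sorted = inj₁ (trans (cong stackSort sorted) (stackSort-increasing 12U↑))
  ... | inj₂ w′₂₁   = stackSort-2X1Y w′₂₁

idPerm-increasing : ∀ n → AllPairs _<_ (idPerm n)
idPerm-increasing n = AllPairsₚ.map⁺ (AllPairsₚ.applyUpTo⁺₁ id n (λ i<j _ → s≤s i<j))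

idPerm-split : ∀ m → idPerm (3 + m) ≡ 1 ∷ 2 ∷ threeTo (3 + m) ++ 3 + m ∷ []
idPerm-split m = cong (λ zs → 1 ∷ 2 ∷ zs) (begin
  map suc (applyUpTo (suc ∘ suc) (suc m)) ≡⟨ map-applyUpTo (suc ∘ suc) suc (suc m) ⟩
  applyUpTo (3 +_) (suc m)                ≡⟨ map-applyUpTo id (3 +_) (suc m) ⟨
  map (3 +_) (upTo (suc m))               ≡⟨ map-cong (+-comm 3) (upTo (suc m)) ⟩
  map (_+ 3) (upTo (suc m))               ≡⟨ cong (map (_+ 3)) (upTo-∷ʳ m) ⟨
  map (_+ 3) (upTo m ∷ʳ m)                ≡⟨ map-++ (_+ 3) (upTo m) (m ∷ []) ⟩
  threeTo (3 + m) ++ m + 3 ∷ []           ≡⟨ cong (λ k → threeTo (3 + m) ++ k ∷ []) (+-comm m 3) ⟩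
  threeTo (3 + m) ++ 3 + m ∷ []           ∎)
  where open ≡-Reasoning

Form2X1Y-2Ln1 : ∀ {n L} → L ↭ threeTo n → Form2X1Y (threeTo n ++ n ∷ []) (2 ∷ L ++ n ∷ 1 ∷ [])
Form2X1Y-2Ln1 {n} {L} L↭ = form (L ++ n ∷ []) [] (cong (2 ∷_) (sym (++-assoc L (n ∷ []) (1 ∷ [])))) []
  (↭-trans (↭-reflexive (++-identityʳ (L ++ n ∷ []))) (++⁺ʳ (n ∷ []) L↭))

lemma5p1 : (n : ℕ) → n ≥ 3 → (L : List ℕ) → L ↭ threeTo n →
    (k : ℕ) → iter k stackSort (2 ∷ L ++ n ∷ 1 ∷ []) ≢ idPerm n →
    head (iter k stackSort (2 ∷ L ++ n ∷ 1 ∷ [])) ≡ just 2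
lemma5p1 (suc (suc (suc m))) (s≤s (s≤s (s≤s z≤n))) L L↭ k sᵏπ≢e
  with iter-stackSort-2X1Y 12U↑ (Form2X1Y-2Ln1 L↭) k
  where
  12U↑ : AllPairs _<_ (1 ∷ 2 ∷ threeTo (3 + m) ++ 3 + m ∷ [])
  12U↑ = subst (AllPairs _<_) (idPerm-split m) (idPerm-increasing (3 + m))
... | inj₁ sᵏπ≡e  = ⊥-elim (sᵏπ≢e (trans sᵏπ≡e (sym (idPerm-split m))))
... | inj₂ sᵏπ₂₁ = cong head (Form2X1Y.shape sᵏπ₂₁)
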